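{- Let $\mathcal Q_1$ be the unary query on unlabelled graphs defined by $\mathcal Q_1(G)=\{u\in V(G):\exists v\in N_G(u)\ \deg_G(u)<\deg_G(v)\}$. Then $\mathcal Q_1$ is computable by a 2-GNN all of whose layers use $\mathrm{SUM}$ aggregation, but it is not computable by any 1-GNN all of whose layers use $\mathrm{SUM}$ aggregation.
   Context: Graphs are finite, simple, undirected; $N_G(v)$ is the neighbourhood and $\deg_G(v)=|N_G(v)|$. An FNN is a composition of layers $\vec x\mapsto\sigma(A\vec x+\vec b)$ with rational weight matrix $A$ and bias $\vec b$, where $\sigma$ is either $\mathrm{ReLU}(x)=\max\{x,0\}$ or the identity, applied coordinatewise. An $\ell$-dimensional signal on $G$ is a map $\mathcal f:V(G)\to\mathbb R^\ell$. A 1-GNN layer of input dimension $p$ and output dimension $q$ is a triple $(\mathrm{msg},\mathrm{agg},\mathrm{comb})$ with $\mathrm{msg}:\mathbb R^p\to\mathbb R^r$ and $\mathrm{comb}:\mathbb R^{p+r}\to\mathbb R^q$ computed by FNNs and $\mathrm{agg}$ one of $\mathrm{SUM},\mathrm{MEAN},\mathrm{MAX}$ (applied coordinatewise to finite multisets of vectors, with value $\vec 0$ on the empty multiset); it maps $(G,\mathcal f)$ to $(G,\mathcal f')$ with $\mathcal f'(v)=\mathrm{comb}\big(\mathcal f(v),\mathrm{agg}(\{\!\{\mathrm{msg}(\mathcal f(w)):w\in N_G(v)\}\!\})\big)$. A 2-GNN layer is the same except $\mathrm{msg}:\mathbb R^{2p}\to\mathbb R^r$ and $\mathcal f'(v)=\mathrm{comb}\big(\mathcal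 f(v),\mathrm{agg}(\{\!\{\mathrm{msg}(\mathcal f(v),\mathcal f(w)):w\in N_G(v)\}\!\})\big)$. An $i$-GNN ($i=1,2$) is a finite sequence of $i$-GNN layers with matching dimensions, computing the composition of the layer maps; its output signal on $(G,\mathcal f)$ is denoted $S_{\mathfrak N}(G,\mathcal f)$. An unlabelled graph is given the $0$-dimensional input signal (every vertex mapped to the empty tuple). A GNN $\mathfrak N$ with output dimension $1$ computes a unary query $\mathcal Q$ if for every input graph $G$ and $v\in V(G)$: $S_{\mathfrak N}(G)(v)\ge 3/4$ if $v\in\mathcal Q(G)$ and $S_{\mathfrak N}(G)(v)\le 1/4$ otherwise. -}

module Defs where

open import Data.Nat using (ℕ; zero; suc) renaming (_<_ to _<ℕ_)
open import Data.Integer using (+_)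
open import Data.Rational using (ℚ; 0ℚ; _+_; _*_; _⊔_; _≤_; _/_)
open import Data.Fin using (Fin)
open import Data.Bool using (Bool; true; false)
open import Data.List using (List; []; _∷_; length; filterᵇ; map)
open import Data.List.Base using (allFin)
open import Data.Vec using (Vec; []; _∷_; zipWith; replicate; foldr; _++_; head)
open import Data.Product using (Σ; _×_; _,_)
open import Relation.Binary.PropositionalEquality using (_≡_)
open import Relation.Nullary using (¬_)

record Graph : Set where
  field
    n      : ℕ
    adj    : Fin n → Fin n → Bool
    sym    : ∀ i j → adj i j ≡ adj j i
    irrefl : ∀ i → adj i i ≡ false
open Graph public

nbrs : (G : Graph) → Fin (n G) → List (Fin (n G))
nbrs G v = filterᵇ (adj G v) (allFin (n G))

deg : (G : Graph) → Fin (n G) → ℕ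
deg G v = length (nbrs G v)

data Act : Set where
  relu ident : Act

relu' : ℚ → ℚ
relu' x = x ⊔ 0ℚ

applyAct : Act → ℚ → ℚ
applyAct relu  = relu'
applyAct ident = λ x → x

dot : ∀ {m} → Vec ℚ m → Vec ℚ m → ℚ
dot xs ys = foldr _ _+_ 0ℚ (zipWith _*_ xs ys)

record FLayer (m k : ℕ) : Set where
  constructor flayer
  field
    A : Vec (Vec ℚ m) k
    b : Vec ℚ k
    σ : Act

evalFLayer : ∀ {m k} → FLayer m k → Vec ℚ m → Vec ℚ k
evalFLayer (flayer A b σ) x = Data.Vec.map (applyAct σ) (zipWith (λ row bi → dot row x + bi) A b)

data FNN : ℕ → ℕ → Set where
  [_]  : ∀ {m k} → FLayer m k → FNN m k
  _▷_  : ∀ {m j k} → FLayer m j → FNN j k → FNN m k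

evalFNN : ∀ {m k} → FNN m k → Vec ℚ m → Vec ℚ k
evalFNN [ L ]   x = evalFLayer L x
evalFNN (L ▷ N) x = evalFNN N (evalFLayer L x)

data Agg : Set where
  SUM MEAN MAX : Agg

vsum : ∀ {r} → List (Vec ℚ r) → Vec ℚ r
vsum []       = replicate _ 0ℚ
vsum (x ∷ xs) = zipWith _+_ x (vsum xs)

vmax : ∀ {r} → List (Vec ℚ r) → Vec ℚ r
vmax []           = replicate _ 0ℚ
vmax (x ∷ [])     = x
vmax (x ∷ y ∷ xs) = zipWith _⊔_ x (vmax (y ∷ xs))

vmean : ∀ {r} → List (Vec ℚ r) → Vec ℚ r
vmean []       = replicate _ 0ℚ
vmean (x ∷ xs) = Data.Vec.map (λ c → c * ((+ 1) / suc (length xs))) (vsum (x ∷ xs))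

aggregate : Agg → ∀ {r} → List (Vec ℚ r) → Vec ℚ r
aggregate SUM  = vsum
aggregate MEAN = vmean
aggregate MAX  = vmax

Signal : Graph → ℕ → Set
Signal G ℓ = Fin (n G) → Vec ℚ ℓ

emptySignal : (G : Graph) → Signal G 0
emptySignal G _ = []

record Layer1 (p q : ℕ) : Set where
  constructor layer1
  field
    r    : ℕ
    msg  : FNN p r
    agg  : Agg
    comb : FNN (p Data.Nat.+ r) q

applyLayer1 : ∀ {p q} → Layer1 p q → (G : Graph) → Signal G p → Signal G q
applyLayer1 (layer1 r msg agg comb) G f v =
  evalFNN comb (f v ++ aggregate agg (map (λ w → evalFNN msg (f w)) (nbrs G v)))

data GNN1 : ℕ → ℕ → Set where
  nil : ∀ {p} → GNN1 p p
  _∷_ : ∀ {p q s} → Layer1 p q → GNN1 q s → GNN1 p s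

run1 : ∀ {p s} → GNN1 p s → (G : Graph) → Signal G p → Signal G s
run1 nil      G f = f
run1 (L ∷ N)  G f = run1 N G (applyLayer1 L G f)

AllSum1 : ∀ {p s} → GNN1 p s → Set
AllSum1 nil     = Data.Unit.⊤ where import Data.Unit
AllSum1 (L ∷ N) = (Layer1.agg L ≡ SUM) × AllSum1 N

record Layer2 (p q : ℕ) : Set where
  constructor layer2
  field
    r    : ℕ
    msg  : FNN (p Data.Nat.+ p) r
    agg  : Agg
    comb : FNN (p Data.Nat.+ r) q

applyLayer2 : ∀ {p q} → Layer2 p q → (G : Graph) → Signal G p → Signal G q
applyLayer2 (layer2 r msg agg comb) G f v =
  evalFNN comb (f v ++ aggregate agg (map (λ w → evalFNN msg (f v ++ f w)) (nbrs G v)))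

data GNN2 : ℕ → ℕ → Set where
  nil : ∀ {p} → GNN2 p p
  _∷_ : ∀ {p q s} → Layer2 p q → GNN2 q s → GNN2 p s

run2 : ∀ {p s} → GNN2 p s → (G : Graph) → Signal G p → Signal G s
run2 nil      G f = f
run2 (L ∷ N)  G f = run2 N G (applyLayer2 L G f)

AllSum2 : ∀ {p s} → GNN2 p s → Set
AllSum2 nil     = Data.Unit.⊤ where import Data.Unit
AllSum2 (L ∷ N) = (Layer2.agg L ≡ SUM) × AllSum2 N

UnaryQuery : Set₁
UnaryQuery = (G : Graph) → Fin (n G) → Set

Separates : (G : Graph) → Signal G 1 → (Fin (n G) → Set) → Set
Separates G S Q = ∀ v → (Q v → (+ 3 / 4) ≤ head (S v)) × (¬ Q v → head (S v) ≤ (+ 1 / 4))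

Computes1 : GNN1 0 1 → UnaryQuery → Set
Computes1 N Q = ∀ G → Separates G (run1 N G (emptySignal G)) (Q G)

Computes2 : GNN2 0 1 → UnaryQuery → Set
Computes2 N Q = ∀ G → Separates G (run2 N G (emptySignal G)) (Q G)

Q₁ : UnaryQuery
Q₁ G u = Σ (Fin (n G)) λ v → (adj G u v ≡ true) × (deg G u <ℕ deg G v)

-- The 2-GNN first computes every degree (sum of the constant message 1) and then lets w send
-- v the indicator [deg v < deg w]; on integers both this indicator and the final clipping of
-- the sum to {0, 1} are t ↦ relu t − relu (t − 1).
--
-- For a SUM 1-GNN, consider complete bipartite graphs K_{x,y}.  All vertices on one side carry
-- the same value, and each layer multiplies the neighbours' messages by the degree, y on the
-- left and x on the right.  For x, y beyond a threshold every value at a left vertex is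
-- therefore c₀ + c₁ y + c₂ y x + c₃ y x y + ⋯ for fixed coefficients: an affine map keeps this
-- shape, and so does relu, because for large x, y the sign of such a form is that of its last
-- non-zero coefficient.  Thus the output minus ½ is, for all large x and y at once, either
-- ≥ 0 or < 0.  But Q₁ fails at a left vertex of K_{t+1,t+1} and holds at one of K_{t+2,t+1}.

module Submission where

open import Defs hiding (sym)
open import Data.Product using (Σ; _×_)
open import Relation.Nullary using (¬_)

open import Data.Bool using (Bool; true; false; not; _xor_; T; if_then_else_)
open import Data.Bool.Properties using (T?; T-≡; xor-comm; xor-same)
open import Data.Empty using (⊥)
open import Data.Fin using (Fin; zero; suc; _↑ˡ_; _↑ʳ_)
open import Data.Integer as ℤ using (+≤+; -≤+)
import Data.Integer.Properties as ℤ
open import Data.List using (List; []; _∷_; _++_; length; map; foldr; filter; filterᵇ; tabulate; allFin)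
open import Data.List.Membership.Propositional using (_∈_)
open import Data.List.Membership.Propositional.Properties using (∈-filter⁺; ∈-filter⁻; ∈-allFin)
open import Data.List.Properties using (map-cong; filter-++; filter-all; filter-none; length-tabulate; ++-identityʳ)
open import Data.List.Relation.Unary.All.Properties using (tabulate⁺)
open import Data.List.Relation.Unary.Any using (here; there)
open import Data.Nat as ℕ using (ℕ; zero; suc; _⊔_; z≤n; s≤s)
import Data.Nat.Properties as ℕ
open import Data.Product using (∃-syntax; _,_; proj₁; proj₂)
open import Data.Rational
  using (ℚ; mkℚ; >-nonZero; nonNegative; 0ℚ; 1ℚ; ½; _+_; _*_; _-_; -_; _≤_; _<_; *≤*; 1/_; _/_)
open import Data.Rational.Literals using (fromℤ)
open import Data.Rational.Properties
open import Data.Rational.Solver using (module +-*-Solver)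
import Data.Rational.Unnormalised as ℚᵘ
import Data.Rational.Unnormalised.Properties as ℚᵘ
open import Data.Sum using (_⊎_; inj₁; inj₂)
open import Data.Vec as Vec using (Vec; []; _∷_; head)
import Data.Vec.Properties as Vec
open import Function using (_∘_; id; flip; Equivalence)
open import Relation.Binary using (tri<; tri≈; tri>)
open import Relation.Binary.PropositionalEquality
open import Relation.Nullary using (yes; no)

open +-*-Solver using (solve; _:=_; _:+_; _:*_; _:-_; :-_; con)

fromℕ : ℕ → ℚ
fromℕ n = fromℤ (ℤ.+ n)

fromℕ-+ : ∀ m n → fromℕ (m ℕ.+ n) ≡ fromℕ m + fromℕ n
fromℕ-+ m n = sym (toℚᵘ-injective (ℚᵘ.≃-trans (toℚᵘ-homo-+ (fromℕ m) (fromℕ n)) (ℚᵘ.*≡* eq)))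
  where
  eq : (ℤ.+ m ℤ.* ℤ.+ 1 ℤ.+ ℤ.+ n ℤ.* ℤ.+ 1) ℤ.* ℤ.+ 1 ≡ ℤ.+ (m ℕ.+ n) ℤ.* (ℤ.+ 1 ℤ.* ℤ.+ 1)
  eq = trans (ℤ.*-identityʳ _)
      (trans (cong₂ ℤ._+_ (ℤ.*-identityʳ (ℤ.+ m)) (ℤ.*-identityʳ (ℤ.+ n))) (sym (ℤ.*-identityʳ _)))

fromℕ-mono-≤ : ∀ {m n} → m ℕ.≤ n → fromℕ m ≤ fromℕ n
fromℕ-mono-≤ {m} {n} m≤n = *≤* (subst₂ ℤ._≤_ (ℤ.pos-* m 1) (ℤ.pos-* n 1) (+≤+ (ℕ.*-monoˡ-≤ 1 m≤n)))

fromℕ-nonNeg : ∀ n → 0ℚ ≤ fromℕ n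
fromℕ-nonNeg n = fromℕ-mono-≤ z≤n

archimedean : ∀ q → ∃[ n ] q ≤ fromℕ n
archimedean (mkℚ (ℤ.+ k) d _)     = k , *≤* (subst₂ ℤ._≤_ (ℤ.pos-* k 1) (ℤ.pos-* k (suc d))
                                            (+≤+ (ℕ.*-monoʳ-≤ k (s≤s z≤n))))
archimedean (mkℚ ℤ.-[1+ _ ] _ _) = 0 , *≤* -≤+

archimedean-* : ∀ q {δ} → 0ℚ < δ → ∃[ n ] q ≤ fromℕ n * δ
archimedean-* q {δ} 0<δ = let n , q/δ≤n = archimedean (q * 1/ δ) in n , (begin
  q               ≡⟨ sym (trans (*-assoc q (1/ δ) δ) (trans (cong (q *_) (*-inverseˡ δ)) (*-identityʳ q))) ⟩
  q * 1/ δ * δ    ≤⟨ *-monoʳ-≤-nonNeg δ {{nonNegative (<⇒≤ 0<δ)}} q/δ≤n ⟩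
  fromℕ n * δ     ∎)
  where
  open ≤-Reasoning
  instance _ = >-nonZero 0<δ

0≤p-q⇒q≤p : ∀ {p q} → 0ℚ ≤ p - q → q ≤ p
0≤p-q⇒q≤p {p} {q} 0≤p-q = subst₂ _≤_ (+-identityˡ q) (solve 2 (λ p q → (p :- q) :+ q := p) refl p q)
  (+-monoˡ-≤ q 0≤p-q)

0<q-p⇒p<q : ∀ {p q} → 0ℚ < q - p → p < q
0<q-p⇒p<q {p} {q} 0<q-p = subst₂ _<_ (+-identityˡ p) (solve 2 (λ p q → (q :- p) :+ p := q) refl p q)
  (+-monoˡ-< p 0<q-p)

p≤q⇒0≤q-p : ∀ {p q} → p ≤ q → 0ℚ ≤ q - p
p≤q⇒0≤q-p {p} {q} p≤q = subst (_≤ q - p) (+-inverseʳ p) (+-monoˡ-≤ (- p) p≤q)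

p≤q⇒p-q≤0 : ∀ {p q} → p ≤ q → p - q ≤ 0ℚ
p≤q⇒p-q≤0 {p} {q} p≤q = subst (p - q ≤_) (+-inverseʳ q) (+-monoˡ-≤ (- q) p≤q)

-- Eventual behaviour of alternating forms

Eventually : (ℕ → ℕ → Set) → Set
Eventually P = ∃[ K ] ∀ {a b} → K ℕ.≤ a → K ℕ.≤ b → P a b

module _ {P Q : ℕ → ℕ → Set} where

  eventually-map : (∀ {a b} → P a b → Q a b) → Eventually P → Eventually Q
  eventually-map f (K , p) = K , λ Ka Kb → f (p Ka Kb)

  eventually-× : Eventually P → Eventually Q → Eventually (λ a b → P a b × Q a b)
  eventually-× (K , p) (M , q) = K ⊔ M , λ Ka Kb →
    p (ℕ.m⊔n≤o⇒m≤o K M Ka) (ℕ.m⊔n≤o⇒m≤o K M Kb) ,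
    q (ℕ.m⊔n≤o⇒n≤o K M Ka) (ℕ.m⊔n≤o⇒n≤o K M Kb)

eventually-flip : ∀ {P : ℕ → ℕ → Set} → Eventually P → Eventually (flip P)
eventually-flip (K , p) = K , λ Ka Kb → p Kb Ka

always : ∀ {P : ℕ → ℕ → Set} → (∀ a b → P a b) → Eventually P
always p = 0 , λ {a b} _ _ → p a b

-- The form c₀ ∷ c₁ ∷ c₂ ∷ c₃ ∷ … denotes c₀ + c₁ a + c₂ a b + c₃ a b a + ⋯ .
Form : Set
Form = List ℚ

evalᶠ : ℕ → ℕ → Form → ℚ
evalᶠ a b []      = 0ℚ
evalᶠ a b (c ∷ L) = c + fromℕ a * evalᶠ b a L

_+ᶠ_ : Form → Form → Form
[]      +ᶠ M       = M
(c ∷ L) +ᶠ []      = c ∷ L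
(c ∷ L) +ᶠ (d ∷ M) = (c + d) ∷ (L +ᶠ M)

_·ᶠ_ : ℚ → Form → Form
k ·ᶠ L = map (k *_) L

-ᶠ_ : Form → Form
-ᶠ L = map -_ L

evalᶠ-+ᶠ : ∀ a b L M → evalᶠ a b (L +ᶠ M) ≡ evalᶠ a b L + evalᶠ a b M
evalᶠ-+ᶠ a b []      M       = sym (+-identityˡ _)
evalᶠ-+ᶠ a b (c ∷ L) []      = sym (+-identityʳ _)
evalᶠ-+ᶠ a b (c ∷ L) (d ∷ M) rewrite evalᶠ-+ᶠ b a L M =
  solve 5 (λ c d a u v → (c :+ d) :+ a :* (u :+ v) := (c :+ a :* u) :+ (d :+ a :* v))
        refl c d (fromℕ a) (evalᶠ b a L) (evalᶠ b a M)

evalᶠ-·ᶠ : ∀ a b k L → evalᶠ a b (k ·ᶠ L) ≡ k * evalᶠ a b L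
evalᶠ-·ᶠ a b k []      = sym (*-zeroʳ k)
evalᶠ-·ᶠ a b k (c ∷ L) rewrite evalᶠ-·ᶠ b a k L =
  solve 4 (λ k c a u → k :* c :+ a :* (k :* u) := k :* (c :+ a :* u)) refl k c (fromℕ a) (evalᶠ b a L)

evalᶠ--ᶠ : ∀ a b L → evalᶠ a b (-ᶠ L) ≡ - evalᶠ a b L
evalᶠ--ᶠ a b []      = refl
evalᶠ--ᶠ a b (c ∷ L) rewrite evalᶠ--ᶠ b a L =
  solve 3 (λ c a u → :- c :+ a :* (:- u) := :- (c :+ a :* u)) refl c (fromℕ a) (evalᶠ b a L)

evalᶠ-const : ∀ a b c → evalᶠ a b (c ∷ []) ≡ c
evalᶠ-const a b c = trans (cong (c +_) (*-zeroʳ (fromℕ a))) (+-identityʳ c)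

evalᶠ-shift : ∀ a b L → evalᶠ a b (0ℚ ∷ L) ≡ fromℕ a * evalᶠ b a L
evalᶠ-shift a b L = +-identityˡ _

Vanishing : Form → Set
Vanishing L = ∀ a b → evalᶠ a b L ≡ 0ℚ

EventuallyPositive : Form → Set
EventuallyPositive L = ∃[ δ ] 0ℚ < δ × Eventually (λ a b → δ ≤ evalᶠ a b L)

vanishing-∷ : ∀ c L → Vanishing L → ∀ a b → evalᶠ a b (c ∷ L) ≡ c
vanishing-∷ c L zero-L a b = trans (cong (λ e → c + fromℕ a * e) (zero-L b a)) (evalᶠ-const a b c)

vanishing--ᶠ : ∀ L → Vanishing L → Vanishing (-ᶠ L)
vanishing--ᶠ L zero-L a b = trans (evalᶠ--ᶠ a b L) (cong -_ (zero-L a b))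

-- Once a ≥ (δ - c)/δ, the term a · e with e ≥ δ outweighs any constant c.
positive-∷ : ∀ c L → EventuallyPositive L → EventuallyPositive (c ∷ L)
positive-∷ c L (δ , 0<δ , K , δ≤L) = let N , δ-c≤Nδ = archimedean-* (δ - c) 0<δ in
  δ , 0<δ , K ⊔ N , λ {a b} Ka Kb → begin
    δ                            ≡⟨ solve 2 (λ c δ → δ := c :+ (δ :- c)) refl c δ ⟩
    c + (δ - c)                  ≤⟨ +-monoʳ-≤ c δ-c≤Nδ ⟩
    c + fromℕ N * δ              ≤⟨ +-monoʳ-≤ c (*-monoʳ-≤-nonNeg δ {{nonNegative (<⇒≤ 0<δ)}}
                                      (fromℕ-mono-≤ (ℕ.m⊔n≤o⇒n≤o K N Ka))) ⟩
    c + fromℕ a * δ              ≤⟨ +-monoʳ-≤ c (*-monoˡ-≤-nonNeg (fromℕ a) {{nonNegative (fromℕ-nonNeg a)}}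
                                      (δ≤L (ℕ.m⊔n≤o⇒m≤o K N Kb) (ℕ.m⊔n≤o⇒m≤o K N Ka))) ⟩
    c + fromℕ a * evalᶠ b a L    ∎
  where open ≤-Reasoning

constant-positive : ∀ {c} L → 0ℚ < c → Vanishing L → EventuallyPositive (c ∷ L)
constant-positive {c} L 0<c zero-L = c , 0<c , always λ a b → ≤-reflexive (sym (vanishing-∷ c L zero-L a b))

data Sign (L : Form) : Set where
  vanishing : Vanishing L → Sign L
  positive  : EventuallyPositive L → Sign L
  negative  : EventuallyPositive (-ᶠ L) → Sign L

sign : ∀ L → Sign L
sign []      = vanishing λ _ _ → refl
sign (c ∷ L) with sign L
... | positive p = positive (positive-∷ c L p)
... | negative p = negative (positive-∷ (- c) (-ᶠ L) p)
... | vanishing zero-L with <-cmp c 0ℚ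
...   | tri< c<0 _ _ = negative (constant-positive (-ᶠ L) (neg-antimono-< c<0) (vanishing--ᶠ L zero-L))
...   | tri≈ _ c≡0 _ = vanishing λ a b → trans (vanishing-∷ c L zero-L a b) c≡0
...   | tri> _ _ 0<c = positive (constant-positive L 0<c zero-L)

evalᶠ-subtract : ∀ a b L q → evalᶠ a b (L +ᶠ (- q ∷ [])) ≡ evalᶠ a b L - q
evalᶠ-subtract a b L q = trans (evalᶠ-+ᶠ a b L (- q ∷ [])) (cong (evalᶠ a b L +_) (evalᶠ-const a b (- q)))

eventually-≥-or-< : ∀ L q → Eventually (λ a b → q ≤ evalᶠ a b L) ⊎ Eventually (λ a b → evalᶠ a b L < q)
eventually-≥-or-< L q with sign (L +ᶠ (- q ∷ []))
... | vanishing zero-L = inj₁ (always λ a b →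
  0≤p-q⇒q≤p (≤-reflexive (sym (trans (sym (evalᶠ-subtract a b L q)) (zero-L a b)))))
... | positive (δ , 0<δ , pos) = inj₁ (eventually-map (λ {a b} δ≤ →
  0≤p-q⇒q≤p (≤-trans (<⇒≤ 0<δ) (subst (δ ≤_) (evalᶠ-subtract a b L q) δ≤))) pos)
... | negative (δ , 0<δ , pos) = inj₂ (eventually-map (λ {a b} δ≤ →
  0<q-p⇒p<q (<-≤-trans 0<δ (subst (δ ≤_) (negated a b) δ≤))) pos)
  where
  negated : ∀ a b → evalᶠ a b (-ᶠ (L +ᶠ (- q ∷ []))) ≡ q - evalᶠ a b L
  negated a b = trans (evalᶠ--ᶠ a b (L +ᶠ (- q ∷ []))) (trans (cong -_ (evalᶠ-subtract a b L q))
    (solve 2 (λ e q → :- (e :- q) := q :- e) refl (evalᶠ a b L) q))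

relu-eventually : ∀ L → ∃[ L′ ] Eventually (λ a b → relu' (evalᶠ a b L) ≡ evalᶠ a b L′)
relu-eventually L with eventually-≥-or-< L 0ℚ
... | inj₁ nonneg   = L  , eventually-map p≥q⇒p⊔q≡p nonneg
... | inj₂ neg      = [] , eventually-map (p≤q⇒p⊔q≡q ∘ <⇒≤) neg

evalᵛ : ∀ {k} → ℕ → ℕ → Vec Form k → Vec ℚ k
evalᵛ a b = Vec.map (evalᶠ a b)

EventuallyForms : ∀ {k} → (ℕ → ℕ → Vec ℚ k) → Set
EventuallyForms F = ∃[ ys ] Eventually (λ a b → F a b ≡ evalᵛ a b ys)

dotᶠ : ∀ {m} → Vec ℚ m → Vec Form m → Form
dotᶠ []       []       = []
dotᶠ (w ∷ ws) (x ∷ xs) = (w ·ᶠ x) +ᶠ dotᶠ ws xs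

evalᶠ-dotᶠ : ∀ {m} a b (ws : Vec ℚ m) xs → evalᶠ a b (dotᶠ ws xs) ≡ dot ws (evalᵛ a b xs)
evalᶠ-dotᶠ a b []       []       = refl
evalᶠ-dotᶠ a b (w ∷ ws) (x ∷ xs) =
  trans (evalᶠ-+ᶠ a b (w ·ᶠ x) (dotᶠ ws xs)) (cong₂ _+_ (evalᶠ-·ᶠ a b w x) (evalᶠ-dotᶠ a b ws xs))

evalᶠ-affine : ∀ {m} a b (ws : Vec ℚ m) xs c → evalᶠ a b (dotᶠ ws xs +ᶠ (c ∷ [])) ≡ dot ws (evalᵛ a b xs) + c
evalᶠ-affine a b ws xs c =
  trans (evalᶠ-+ᶠ a b (dotᶠ ws xs) (c ∷ [])) (cong₂ _+_ (evalᶠ-dotᶠ a b ws xs) (evalᶠ-const a b c))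

applyAct-eventually : ∀ σ L → ∃[ L′ ] Eventually (λ a b → applyAct σ (evalᶠ a b L) ≡ evalᶠ a b L′)
applyAct-eventually relu  L = relu-eventually L
applyAct-eventually ident L = L , always λ _ _ → refl

evalFLayer-eventually : ∀ {m k} (ℓ : FLayer m k) xs → EventuallyForms (λ a b → evalFLayer ℓ (evalᵛ a b xs))
evalFLayer-eventually (flayer []      []       σ) xs = [] , always λ _ _ → refl
evalFLayer-eventually (flayer (w ∷ A) (c ∷ bs) σ) xs
  with applyAct-eventually σ (dotᶠ w xs +ᶠ (c ∷ [])) | evalFLayer-eventually (flayer A bs σ) xs
... | L , first≡ | ys , rest≡ = L ∷ ys , eventually-map (λ {a b} (first , rest) →
  cong₂ _∷_ (trans (cong (applyAct σ) (sym (evalᶠ-affine a b w xs c))) first) rest) (eventually-× first≡ rest≡)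

evalFNN-eventually : ∀ {m k} (N : FNN m k) xs → EventuallyForms (λ a b → evalFNN N (evalᵛ a b xs))
evalFNN-eventually [ ℓ ]   xs = evalFLayer-eventually ℓ xs
evalFNN-eventually (ℓ ▷ N) xs with evalFLayer-eventually ℓ xs
... | ys , ℓ≡ with evalFNN-eventually N ys
...   | zs , N≡ = zs , eventually-map (λ (ℓ-step , N-step) → trans (cong (evalFNN N) ℓ-step) N-step)
                                     (eventually-× ℓ≡ N≡)

vsum-const : ∀ {A : Set} {r} (g : A → Vec ℚ r) c l → (∀ {w} → w ∈ l → g w ≡ c) →
             vsum (map g l) ≡ Vec.map (fromℕ (length l) *_) c
vsum-const g c []      _   = zeros c
  where
  zeros : ∀ {r} (c : Vec ℚ r) → Vec.replicate r 0ℚ ≡ Vec.map (fromℕ 0 *_) c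
  zeros []      = refl
  zeros (x ∷ c) = cong₂ _∷_ (sym (*-zeroˡ x)) (zeros c)
vsum-const g c (w ∷ l) g≡c =
  trans (cong₂ (Vec.zipWith _+_) (g≡c (here refl)) (vsum-const g c l (g≡c ∘ there))) (add-one c)
  where
  add-one : ∀ {r} (c : Vec ℚ r) → Vec.zipWith _+_ c (Vec.map (fromℕ (length l) *_) c)
                                  ≡ Vec.map (fromℕ (suc (length l)) *_) c
  add-one []      = refl
  add-one (x ∷ c) = cong₂ _∷_ (trans (solve 2 (λ x n → x :+ n :* x := (con 1ℚ :+ n) :* x) refl x (fromℕ (length l)))
                                     (cong (_* x) (sym (fromℕ-+ 1 (length l)))))
                              (add-one c)

sumℚ : List ℚ → ℚ
sumℚ = foldr _+_ 0ℚ

vsum-singletons : ∀ {A : Set} (h : A → ℚ) l → vsum (map (λ w → h w ∷ []) l) ≡ sumℚ (map h l) ∷ []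
vsum-singletons h []      = refl
vsum-singletons h (w ∷ l) rewrite vsum-singletons h l = refl

module _ {A : Set} (h : A → ℚ) where

  sumℚ-nonNeg : ∀ {l} → (∀ {u} → u ∈ l → 0ℚ ≤ h u) → 0ℚ ≤ sumℚ (map h l)
  sumℚ-nonNeg {[]}    _      = ≤-refl
  sumℚ-nonNeg {u ∷ l} nonNeg = +-mono-≤ (nonNeg (here refl)) (sumℚ-nonNeg (nonNeg ∘ there))

  member≤sumℚ : ∀ {l w} → (∀ {u} → u ∈ l → 0ℚ ≤ h u) → w ∈ l → h w ≤ sumℚ (map h l)
  member≤sumℚ {u ∷ l} nonNeg (here refl) =
    subst (_≤ sumℚ (map h (u ∷ l))) (+-identityʳ (h u)) (+-monoʳ-≤ (h u) (sumℚ-nonNeg (nonNeg ∘ there)))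
  member≤sumℚ {u ∷ l} nonNeg (there w∈l) =
    subst (_≤ sumℚ (map h (u ∷ l))) (+-identityˡ _)
          (+-mono-≤ (nonNeg (here refl)) (member≤sumℚ (nonNeg ∘ there) w∈l))

  sumℚ-zero : ∀ {l} → (∀ {u} → u ∈ l → h u ≡ 0ℚ) → sumℚ (map h l) ≡ 0ℚ
  sumℚ-zero {[]}    _    = refl
  sumℚ-zero {u ∷ l} zeros = cong₂ _+_ (zeros (here refl)) (sumℚ-zero (zeros ∘ there))

∈-nbrs⁺ : ∀ G {v u} → adj G v u ≡ true → u ∈ nbrs G v
∈-nbrs⁺ G {v} {u} adj≡ = ∈-filter⁺ (T? ∘ adj G v) (∈-allFin u) (Equivalence.from T-≡ adj≡)

∈-nbrs⁻ : ∀ G {v u} → u ∈ nbrs G v → adj G v u ≡ true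
∈-nbrs⁻ G {v} u∈ = Equivalence.to T-≡ (proj₂ (∈-filter⁻ (T? ∘ adj G v) {xs = allFin (n G)} u∈))

-- Complete bipartite graphs

isLeft : ∀ x {y} → Fin (x ℕ.+ y) → Bool
isLeft zero    _       = false
isLeft (suc x) zero    = true
isLeft (suc x) (suc i) = isLeft x i

isLeft-↑ˡ : ∀ {x} y (i : Fin x) → isLeft x (i ↑ˡ y) ≡ true
isLeft-↑ˡ y zero    = refl
isLeft-↑ˡ y (suc i) = isLeft-↑ˡ y i

isLeft-↑ʳ : ∀ x {y} (j : Fin y) → isLeft x (x ↑ʳ j) ≡ false
isLeft-↑ʳ zero    j = refl
isLeft-↑ʳ (suc x) j = isLeft-↑ʳ x j

completeBipartite : ℕ → ℕ → Graph
completeBipartite x y = record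
  { n      = x ℕ.+ y
  ; adj    = λ i j → isLeft x i xor isLeft x j
  ; sym    = λ i j → xor-comm (isLeft x i) (isLeft x j)
  ; irrefl = λ i → xor-same (isLeft x i)
  }

tabulate-+ : ∀ {A : Set} x y (f : Fin (x ℕ.+ y) → A) →
             tabulate f ≡ tabulate (f ∘ (_↑ˡ y)) ++ tabulate (f ∘ (x ↑ʳ_))
tabulate-+ zero    y f = refl
tabulate-+ (suc x) y f = cong (f zero ∷_) (tabulate-+ x y (f ∘ suc))

module _ {A : Set} {k} (p : A → Bool) (f : Fin k → A) where

  filterᵇ-tabulate-false : (∀ i → p (f i) ≡ false) → filterᵇ p (tabulate f) ≡ []
  filterᵇ-tabulate-false rejected = filter-none (T? ∘ p) (tabulate⁺ λ i → subst T (rejected i))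

  filterᵇ-tabulate-true : (∀ i → p (f i) ≡ true) → filterᵇ p (tabulate f) ≡ tabulate f
  filterᵇ-tabulate-true accepted = filter-all (T? ∘ p) (tabulate⁺ λ i → subst T (sym (accepted i)) _)

module _ (x y : ℕ) where

  private
    K = completeBipartite x y

    inl : Fin x → Fin (x ℕ.+ y)
    inl = _↑ˡ y

    inr : Fin y → Fin (x ℕ.+ y)
    inr = x ↑ʳ_

  nbrs-halves : ∀ v → nbrs K v ≡ filterᵇ (adj K v) (tabulate inl) ++ filterᵇ (adj K v) (tabulate inr)
  nbrs-halves v = trans (cong (filterᵇ (adj K v)) (tabulate-+ x y id))
                        (filter-++ (T? ∘ adj K v) (tabulate inl) (tabulate inr))

  deg-left : ∀ {v} → isLeft x v ≡ true → deg K v ≡ y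
  deg-left {v} left = begin
    length (nbrs K v)                                  ≡⟨ cong length (nbrs-halves v) ⟩
    length (filterᵇ (adj K v) (tabulate inl) ++ filterᵇ (adj K v) (tabulate inr))
      ≡⟨ cong₂ (λ l₁ l₂ → length (l₁ ++ l₂))
           (filterᵇ-tabulate-false (adj K v) inl λ i → cong₂ _xor_ left (isLeft-↑ˡ y i))
           (filterᵇ-tabulate-true (adj K v) inr λ j → cong₂ _xor_ left (isLeft-↑ʳ x j)) ⟩
    length (tabulate inr)                              ≡⟨ length-tabulate inr ⟩
    y                                                  ∎
    where open ≡-Reasoning

  deg-right : ∀ {v} → isLeft x v ≡ false → deg K v ≡ x
  deg-right {v} right = begin
    length (nbrs K v)                                  ≡⟨ cong length (nbrs-halves v) ⟩
    length (filterᵇ (adj K v) (tabulate inl) ++ filterᵇ (adj K v) (tabulate inr))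
      ≡⟨ cong₂ (λ l₁ l₂ → length (l₁ ++ l₂))
           (filterᵇ-tabulate-true (adj K v) inl λ i → cong₂ _xor_ right (isLeft-↑ˡ y i))
           (filterᵇ-tabulate-false (adj K v) inr λ j → cong₂ _xor_ right (isLeft-↑ʳ x j)) ⟩
    length (tabulate inl ++ [])                        ≡⟨ cong length (++-identityʳ (tabulate inl)) ⟩
    length (tabulate inl)                              ≡⟨ length-tabulate inl ⟩
    x                                                  ∎
    where open ≡-Reasoning

  adj-opposite : ∀ {v u} → adj K v u ≡ true → isLeft x u ≡ not (isLeft x v)
  adj-opposite {v} {u} with isLeft x v | isLeft x u
  ... | true  | false = λ _ → refl
  ... | false | true  = λ _ → refl
  ... | true  | true  = λ ()
  ... | false | false = λ ()

  nbrs-opposite : ∀ {v w s} → isLeft x v ≡ s → w ∈ nbrs K v → isLeft x w ≡ not s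
  nbrs-opposite side w∈ = trans (adj-opposite (∈-nbrs⁻ K w∈)) (cong not side)

  Q₁-left⁻ : ∀ {v} → isLeft x v ≡ true → Q₁ K v → y ℕ.< x
  Q₁-left⁻ left (w , adj≡ , deg<) =
    subst₂ ℕ._<_ (deg-left left) (deg-right (trans (adj-opposite adj≡) (cong not left))) deg<

  Q₁-left⁺ : ∀ {v} → isLeft x v ≡ true → Fin y → y ℕ.< x → Q₁ K v
  Q₁-left⁺ left j y<x = inr j , cong₂ _xor_ left (isLeft-↑ʳ x j) ,
    subst₂ ℕ._<_ (sym (deg-left left)) (sym (deg-right (isLeft-↑ʳ x j))) y<x

-- SUM-aggregating 1-GNNs on complete bipartite graphs

Forms² : ℕ → Set
Forms² p = Vec Form p × Vec Form p

-- A left vertex of K_{x,y} has degree y, hence its forms are evaluated at (y, x);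
-- a right vertex at (x, y).
sideSignal : ∀ {p} x y → Forms² p → Signal (completeBipartite x y) p
sideSignal x y (FL , FR) v = if isLeft x v then evalᵛ y x FL else evalᵛ x y FR

sideSignal-at : ∀ {p x y} {S : Forms² p} {v s} → isLeft x v ≡ s →
                sideSignal x y S v ≡ (if s then evalᵛ y x (proj₁ S) else evalᵛ x y (proj₂ S))
sideSignal-at {x = x} {y} {S} side = cong (λ s → if s then evalᵛ y x (proj₁ S) else evalᵛ x y (proj₂ S)) side

Simulates : ∀ {p q} → (∀ x y → Signal (completeBipartite x y) p → Signal (completeBipartite x y) q) →
            Forms² p → Forms² q → Set
Simulates F S S′ = Eventually λ x y → ∀ {f} → f ≗ sideSignal x y S → F x y f ≗ sideSignal x y S′

shiftᵛ : ∀ {k} → Vec Form k → Vec Form k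
shiftᵛ = Vec.map (0ℚ ∷_)

shift-evalᵛ : ∀ {k} a b (M : Vec Form k) → Vec.map (fromℕ a *_) (evalᵛ b a M) ≡ evalᵛ a b (shiftᵛ M)
shift-evalᵛ a b []      = refl
shift-evalᵛ a b (L ∷ M) = cong₂ _∷_ (sym (evalᶠ-shift a b L)) (shift-evalᵛ a b M)

applyLayer1-uniform : ∀ {p q r} (msg : FNN p r) (comb : FNN (p ℕ.+ r) q) G f v {a b F F′ M C} →
  deg G v ≡ b → f v ≡ evalᵛ b a F → (∀ {w} → w ∈ nbrs G v → f w ≡ evalᵛ a b F′) →
  evalFNN msg (evalᵛ a b F′) ≡ evalᵛ a b M →
  evalFNN comb (evalᵛ b a (F Vec.++ shiftᵛ M)) ≡ evalᵛ b a C →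
  applyLayer1 (layer1 r msg SUM comb) G f v ≡ evalᵛ b a C
applyLayer1-uniform msg comb G f v {a} {b} {F} {F′} {M} {C} refl fv≡ nbr≡ msg≡ comb≡ = begin
  evalFNN comb (f v Vec.++ vsum (map (λ w → evalFNN msg (f w)) (nbrs G v)))
    ≡⟨ cong₂ (λ u s → evalFNN comb (u Vec.++ s)) fv≡
             (vsum-const _ (evalᵛ a b M) (nbrs G v) (λ w∈ → trans (cong (evalFNN msg) (nbr≡ w∈)) msg≡)) ⟩
  evalFNN comb (evalᵛ b a F Vec.++ Vec.map (fromℕ b *_) (evalᵛ a b M))
    ≡⟨ cong (λ s → evalFNN comb (evalᵛ b a F Vec.++ s)) (shift-evalᵛ b a M) ⟩
  evalFNN comb (evalᵛ b a F Vec.++ evalᵛ b a (shiftᵛ M))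
    ≡⟨ cong (evalFNN comb) (sym (Vec.map-++ (evalᶠ b a) F (shiftᵛ M))) ⟩
  evalFNN comb (evalᵛ b a (F Vec.++ shiftᵛ M))
    ≡⟨ comb≡ ⟩
  evalᵛ b a C ∎
  where open ≡-Reasoning

applyLayer1-simulated : ∀ {p q} (ℓ : Layer1 p q) → Layer1.agg ℓ ≡ SUM → ∀ S →
                        ∃[ S′ ] Simulates (λ x y → applyLayer1 ℓ (completeBipartite x y)) S S′
applyLayer1-simulated (layer1 r msg .SUM comb) refl (FL , FR)
  with evalFNN-eventually msg FL | evalFNN-eventually msg FR
... | ML , msgL | MR , msgR
  with evalFNN-eventually comb (FL Vec.++ shiftᵛ MR)
     | evalFNN-eventually comb (FR Vec.++ shiftᵛ ML)
... | CL , combL | CR , combR = (CL , CR) , eventually-map uniform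
      (eventually-× (eventually-× msgR (eventually-flip combL)) (eventually-× (eventually-flip msgL) combR))
  where
  uniform : ∀ {x y} →
            (evalFNN msg (evalᵛ x y FR) ≡ evalᵛ x y MR ×
             evalFNN comb (evalᵛ y x (FL Vec.++ shiftᵛ MR)) ≡ evalᵛ y x CL) ×
            (evalFNN msg (evalᵛ y x FL) ≡ evalᵛ y x ML ×
             evalFNN comb (evalᵛ x y (FR Vec.++ shiftᵛ ML)) ≡ evalᵛ x y CR) →
            ∀ {f} → f ≗ sideSignal x y (FL , FR) →
            applyLayer1 (layer1 r msg SUM comb) (completeBipartite x y) f ≗ sideSignal x y (CL , CR)
  uniform {x} {y} ((msgR≡ , combL≡) , (msgL≡ , combR≡)) {f} f≡ v = on-side (isLeft x v) refl
    where
    K = completeBipartite x y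
    on-side : ∀ s → isLeft x v ≡ s → applyLayer1 (layer1 r msg SUM comb) K f v ≡ sideSignal x y (CL , CR) v
    on-side true  side = trans
      (applyLayer1-uniform msg comb K f v (deg-left x y side) (trans (f≡ v) (sideSignal-at side))
        (λ w∈ → trans (f≡ _) (sideSignal-at (nbrs-opposite x y side w∈))) msgR≡ combL≡)
      (sym (sideSignal-at side))
    on-side false side = trans
      (applyLayer1-uniform msg comb K f v (deg-right x y side) (trans (f≡ v) (sideSignal-at side))
        (λ w∈ → trans (f≡ _) (sideSignal-at (nbrs-opposite x y side w∈))) msgL≡ combR≡)
      (sym (sideSignal-at side))

run1-simulated : ∀ {p s} (N : GNN1 p s) → AllSum1 N → ∀ S →
                 ∃[ S′ ] Simulates (λ x y → run1 N (completeBipartite x y)) S S′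
run1-simulated nil     _              S = S , always λ _ _ {_} f≡ → f≡
run1-simulated (ℓ ∷ N) (sumℓ , sumN) S with applyLayer1-simulated ℓ sumℓ S
... | S₁ , simℓ with run1-simulated N sumN S₁
...   | S₂ , simN = S₂ , eventually-map (λ (ℓ-step , N-step) {_} f≡ → N-step (ℓ-step f≡))
                                     (eventually-× simℓ simN)

emptySignal-sideSignal : ∀ x y → emptySignal (completeBipartite x y) ≗ sideSignal x y ([] , [])
emptySignal-sideSignal x y v with isLeft x v
... | true  = refl
... | false = refl

½≰¼ : ¬ (½ ≤ ℤ.+ 1 / 4)
½≰¼ = ≤⇒≤ᵇ

¾≰½ : ¬ (ℤ.+ 3 / 4 ≤ ½)
¾≰½ = ≤⇒≤ᵇ

sumGNN1-cannot-compute-Q₁ : (N : GNN1 0 1) → AllSum1 N → ¬ Computes1 N Q₁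
sumGNN1-cannot-compute-Q₁ N allSum computes with run1-simulated N allSum ([] , [])
... | (P ∷ [] , FR) , simulated = refute (eventually-≥-or-< P ½)
  where
  output : ∀ {x y} → (∀ {f} → f ≗ sideSignal (suc x) y ([] , []) →
                      run1 N (completeBipartite (suc x) y) f ≗ sideSignal (suc x) y (P ∷ [] , FR)) →
           head (run1 N (completeBipartite (suc x) y) (emptySignal (completeBipartite (suc x) y)) zero)
             ≡ evalᶠ y (suc x) P
  output {x} {y} sim = cong head (sim (emptySignal-sideSignal (suc x) y) zero)

  refute : Eventually (λ a b → ½ ≤ evalᶠ a b P) ⊎ Eventually (λ a b → evalᶠ a b P < ½) → ⊥
  refute (inj₁ above) =
    let K , both = eventually-× simulated (eventually-flip above)
        sim , ½≤P = both (ℕ.n≤1+n K) (ℕ.n≤1+n K)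
        x = suc K
    in ½≰¼ (≤-trans ½≤P (≤-trans (≤-reflexive (sym (output sim)))
             (proj₂ (computes (completeBipartite x x) zero) λ q → ℕ.<-irrefl refl (Q₁-left⁻ x x {zero} refl q))))
  refute (inj₂ below) =
    let K , both = eventually-× simulated (eventually-flip below)
        sim , P<½ = both (ℕ.m≤n⇒m≤1+n (ℕ.n≤1+n K)) (ℕ.n≤1+n K)
        x = suc (suc K)
        y = suc K
    in ¾≰½ (<⇒≤ (≤-<-trans (≤-trans
             (proj₁ (computes (completeBipartite x y) zero) (Q₁-left⁺ x y {zero} refl zero ℕ.≤-refl))
             (≤-reflexive (output sim))) P<½))

-- A SUM-aggregating 2-GNN for Q₁

-- 0 on (-∞, 0], 1 on [1, ∞): on integers, the indicator of positivity.
step : ℚ → ℚ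
step t = relu' t - relu' (t - 1ℚ)

stepNet : ∀ {m} → Vec ℚ m → FNN m 1
stepNet w = flayer (w ∷ w ∷ []) (0ℚ ∷ - 1ℚ ∷ []) relu
          ▷ [ flayer ((1ℚ ∷ - 1ℚ ∷ []) ∷ []) (0ℚ ∷ []) ident ]

evalFNN-stepNet : ∀ {m} (w x : Vec ℚ m) → evalFNN (stepNet w) x ≡ step (dot w x) ∷ []
evalFNN-stepNet w x = cong (_∷ []) (trans
  (solve 2 (λ r s → con 1ℚ :* r :+ (con (- 1ℚ) :* s :+ con 0ℚ) :+ con 0ℚ := r :- s) refl
     (relu' (dot w x + 0ℚ)) (relu' (dot w x - 1ℚ)))
  (cong (λ r → r - relu' (dot w x - 1ℚ)) (cong relu' (+-identityʳ (dot w x)))))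

step-nonPos : ∀ {t} → t ≤ 0ℚ → step t ≡ 0ℚ
step-nonPos t≤0 =
  cong₂ _-_ (p≤q⇒p⊔q≡q t≤0) (p≤q⇒p⊔q≡q (p≤q⇒p-q≤0 {q = 1ℚ} (≤-trans t≤0 (≤ᵇ⇒≤ _))))

step-≥1 : ∀ {t} → 1ℚ ≤ t → step t ≡ 1ℚ
step-≥1 {t} 1≤t = trans
  (cong₂ _-_ (p≥q⇒p⊔q≡p (≤-trans (≤ᵇ⇒≤ _) 1≤t)) (p≥q⇒p⊔q≡p (p≤q⇒0≤q-p 1≤t)))
  (solve 1 (λ t → t :- (t :- con 1ℚ) := con 1ℚ) refl t)

step-< : ∀ {m k} → m ℕ.< k → step (fromℕ k - fromℕ m) ≡ 1ℚ
step-< {m} {k} m<k = step-≥1 (begin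
  1ℚ                        ≡⟨ solve 2 (λ one m → one := (one :+ m) :- m) refl 1ℚ (fromℕ m) ⟩
  (1ℚ + fromℕ m) - fromℕ m  ≡⟨ cong (_- fromℕ m) (sym (fromℕ-+ 1 m)) ⟩
  fromℕ (suc m) - fromℕ m   ≤⟨ +-monoˡ-≤ (- fromℕ m) (fromℕ-mono-≤ m<k) ⟩
  fromℕ k - fromℕ m         ∎)
  where open ≤-Reasoning

step-≮ : ∀ {m k} → ¬ m ℕ.< k → step (fromℕ k - fromℕ m) ≡ 0ℚ
step-≮ m≮k = step-nonPos (p≤q⇒p-q≤0 (fromℕ-mono-≤ (ℕ.≮⇒≥ m≮k)))

compareNet : FNN (1 ℕ.+ 1) 1
compareNet = stepNet (- 1ℚ ∷ 1ℚ ∷ [])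

clipNet : FNN (1 ℕ.+ 1) 1
clipNet = stepNet (0ℚ ∷ 1ℚ ∷ [])

compareNet-eval : ∀ a b → evalFNN compareNet (a ∷ b ∷ []) ≡ step (b - a) ∷ []
compareNet-eval a b = trans (evalFNN-stepNet (- 1ℚ ∷ 1ℚ ∷ []) (a ∷ b ∷ [])) (cong (λ t → step t ∷ [])
  (solve 2 (λ a b → con (- 1ℚ) :* a :+ (con 1ℚ :* b :+ con 0ℚ) := b :- a) refl a b))

clipNet-eval : ∀ a s → evalFNN clipNet (a ∷ s ∷ []) ≡ step s ∷ []
clipNet-eval a s = trans (evalFNN-stepNet (0ℚ ∷ 1ℚ ∷ []) (a ∷ s ∷ [])) (cong (λ t → step t ∷ [])
  (solve 2 (λ a s → con 0ℚ :* a :+ (con 1ℚ :* s :+ con 0ℚ) := s) refl a s))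

degreeLayer : Layer2 0 1
degreeLayer = layer2 1 [ flayer ([] ∷ []) (1ℚ ∷ []) ident ] SUM [ flayer ((1ℚ ∷ []) ∷ []) (0ℚ ∷ []) ident ]

smallerNeighbourLayer : Layer2 1 1
smallerNeighbourLayer = layer2 1 compareNet SUM clipNet

Q₁-GNN : GNN2 0 1
Q₁-GNN = degreeLayer ∷ smallerNeighbourLayer ∷ nil

degreeLayer-deg : ∀ G v → applyLayer2 degreeLayer G (emptySignal G) v ≡ fromℕ (deg G v) ∷ []
degreeLayer-deg G v = trans
  (cong (evalFNN (Layer2.comb degreeLayer)) (vsum-const _ (1ℚ ∷ []) (nbrs G v) λ _ → refl))
  (cong (_∷ []) (solve 1 (λ d → con 1ℚ :* (d :* con 1ℚ) :+ con 0ℚ :+ con 0ℚ := d) refl (fromℕ (deg G v))))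

applyLayer2-cong : ∀ {p q} (ℓ : Layer2 p q) G {f g : Signal G p} → f ≗ g →
                   applyLayer2 ℓ G f ≗ applyLayer2 ℓ G g
applyLayer2-cong (layer2 r msg agg comb) G f≗g v =
  cong₂ (λ u s → evalFNN comb (u Vec.++ aggregate agg s)) (f≗g v)
        (map-cong (λ w → cong₂ (λ u u′ → evalFNN msg (u Vec.++ u′)) (f≗g v) (f≗g w)) (nbrs G v))

largerDegreeIndicator : ∀ G → Fin (n G) → Fin (n G) → ℚ
largerDegreeIndicator G v w = step (fromℕ (deg G w) - fromℕ (deg G v))

largerDegreeIndicator-nonNeg : ∀ G v w → 0ℚ ≤ largerDegreeIndicator G v w
largerDegreeIndicator-nonNeg G v w with deg G v ℕ.<? deg G w
... | yes lt = ≤-trans (≤ᵇ⇒≤ _) (≤-reflexive (sym (step-< lt)))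
... | no ≮   = ≤-reflexive (sym (step-≮ ≮))

Q₁-GNN-output : ∀ G v → head (run2 Q₁-GNN G (emptySignal G) v)
                        ≡ step (sumℚ (map (largerDegreeIndicator G v) (nbrs G v)))
Q₁-GNN-output G v = cong head (begin
  applyLayer2 smallerNeighbourLayer G (applyLayer2 degreeLayer G (emptySignal G)) v
    ≡⟨ applyLayer2-cong smallerNeighbourLayer G (degreeLayer-deg G) v ⟩
  evalFNN clipNet (d v ∷ vsum (map (λ w → evalFNN compareNet (d v ∷ d w ∷ [])) (nbrs G v)))
    ≡⟨ cong (λ ms → evalFNN clipNet (d v ∷ vsum ms))
            (map-cong (λ w → compareNet-eval (d v) (d w)) (nbrs G v)) ⟩
  evalFNN clipNet (d v ∷ vsum (map (λ w → indicator w ∷ []) (nbrs G v)))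
    ≡⟨ cong (λ s → evalFNN clipNet (d v ∷ s)) (vsum-singletons indicator (nbrs G v)) ⟩
  evalFNN clipNet (d v ∷ sumℚ (map indicator (nbrs G v)) ∷ [])
    ≡⟨ clipNet-eval (d v) (sumℚ (map indicator (nbrs G v))) ⟩
  step (sumℚ (map indicator (nbrs G v))) ∷ [] ∎)
  where
  open ≡-Reasoning
  d : Fin (n G) → ℚ
  d u = fromℕ (deg G u)
  indicator : Fin (n G) → ℚ
  indicator = largerDegreeIndicator G v

Q₁-GNN-computes : Computes2 Q₁-GNN Q₁
Q₁-GNN-computes G v = accept , reject
  where
  indicator : Fin (n G) → ℚ
  indicator = largerDegreeIndicator G v

  accept : Q₁ G v → ℤ.+ 3 / 4 ≤ head (run2 Q₁-GNN G (emptySignal G) v)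
  accept (w , adj≡ , lt) =
    subst (ℤ.+ 3 / 4 ≤_) (sym (trans (Q₁-GNN-output G v) (step-≥1 one≤sum))) (≤ᵇ⇒≤ _)
    where
    one≤sum : 1ℚ ≤ sumℚ (map indicator (nbrs G v))
    one≤sum = ≤-trans (≤-reflexive (sym (step-< lt)))
                      (member≤sumℚ indicator (λ _ → largerDegreeIndicator-nonNeg G v _) (∈-nbrs⁺ G adj≡))

  reject : ¬ Q₁ G v → head (run2 Q₁-GNN G (emptySignal G) v) ≤ ℤ.+ 1 / 4
  reject ¬q =
    subst (_≤ ℤ.+ 1 / 4) (sym (trans (Q₁-GNN-output G v) (trans (cong step sum≡0) (step-nonPos ≤-refl))))
          (≤ᵇ⇒≤ _)
    where
    sum≡0 : sumℚ (map indicator (nbrs G v)) ≡ 0ℚ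
    sum≡0 = sumℚ-zero indicator λ {u} u∈ → step-≮ λ lt → ¬q (u , ∈-nbrs⁻ G u∈ , lt)

theorem5p1 : (Σ (GNN2 0 1) λ N → AllSum2 N × Computes2 N Q₁)
           × ¬ (Σ (GNN1 0 1) λ N → AllSum1 N × Computes1 N Q₁)
theorem5p1 = (Q₁-GNN , (refl , refl , _) , Q₁-GNN-computes)
           , λ (N , allSum , computes) → sumGNN1-cannot-compute-Q₁ N allSum computes
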